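{- Let $\mathcal{T}=(\tau_1,\dots,\tau_n)$ be a task arrival process, with $\tau_i=(\sigma_i,\pi_i,t_i)$. For every $i\in\{1,\dots,n\}$ and every instantly-committing scheduler $\mathsf{alg}$, \[ \widetilde{C}_{\mathsf{ins}}^{t_i}\;\le\; C_{\mathsf{alg}}^{t_i}+K_{\mathsf{alg}}^{t_i}. \]
   Context: One-Fast-Many-Slow Decision Problem: there is a single fast machine and an unlimited number of slow machines. An instance is a task arrival process (TAP) $\mathcal{T}=(\tau_1,\dots,\tau_n)$, where $\tau_i=(\sigma_i,\pi_i,t_i)$ gives the task's runtime $\sigma_i$ on a slow machine, its runtime $\pi_i$ on the fast machine, and its arrival time $t_i$, with $t_1\le\dots\le t_n$. A valid schedule assigns at most one task to each machine at each time, does no work on a task before its arrival time, runs each task on at most one machine, and runs each task $\tau_i$ either for a total of $\sigma_i$ time on some slow machine or for a total of $\pi_i$ time on the fast machine. The completion time of a schedule is the time when the last task finishes. An online scheduler learns each task only at its arrival time; an instantly-committing scheduler must fix, at each task's arrival time, which machine that task will run on (irrevocably). For $t\ge 0$, $\mathcal{T}^{t}$ denotes the truncation of $\mathcal{T}$ to the tasks with $t_i\le t$, and $C^{t}$ denotes the minimum completion time of any valid (offline) schedule for $\mathcal{T}^{t}$. For a scheduler $\mathsf{alg}$, $C_{\mathsf{alg}}^{t}$ is the completion time of $\mathsf{alg}$ on $\mathcal{T}^{t}$, and $K_{\mathsf{alg}}^{t}$ is the sum of $\pi_j$ over all tasks $\tau_j\in\mathcal{T}^{t}$ that $\mathsf{alg}$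 runs on the fast machine. $\widetilde{C}_{\mathsf{alg}}^{t}$ is the completion time of the fast machine of $\mathsf{alg}$ on $\mathcal{T}^t$, i.e. the final time at which the fast machine has work. The scheduler $\mathsf{ins}$ is the instantly-committing scheduler which, when task $\tau_i$ arrives, runs $\tau_i$ on the fast machine if $\sigma_i+t_i>2C^{t_i}$ (the fast machine processing its tasks in order of arrival), and otherwise runs $\tau_i$ on a (fresh) slow machine starting at its arrival. -}

module Defs where

open import Data.Nat as ℕ using (ℕ)
open import Data.Fin using (Fin; toℕ)
open import Data.Bool using (Bool; true; false; if_then_else_)
open import Data.Product using (Σ; _×_; _,_; proj₁; proj₂; ∃)
open import Data.List using (List; []; _∷_; length; filter; upTo; concatMap; foldr; foldl; lookup; map)
open import Data.List.Relation.Unary.All using (All)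
open import Data.List.Relation.Unary.AllPairs using (AllPairs)
open import Data.List.Relation.Unary.Linked using (Linked)
open import Data.Rational using (ℚ; 0ℚ; 1ℚ; _+_; _-_; _*_; _⊔_; _⊓_; _≤_; _<_)
open import Data.Rational.Properties using (_≤?_; _<?_)
open import Relation.Nullary using (Dec; yes; no; does)
open import Relation.Binary.PropositionalEquality using (_≡_)

record Task : Set where
  constructor task
  field
    σ : ℚ   -- runtime on a slow machine
    π : ℚ   -- runtime on the fast machine
    t : ℚ   -- arrival time
open Task public

IsTAP : List Task → Set
IsTAP T = All (λ τ → (0ℚ < σ τ) × (0ℚ < π τ) × (0ℚ ≤ t τ)) T
        × Linked (λ τ τ′ → t τ ≤ t τ′) T

truncate : List Task → ℚ → List Task
truncate T s = filter (λ τ → t τ ≤? s) T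

data Machine : Set where
  fast : Machine
  slow : ℕ → Machine

_≟M_ : (m m′ : Machine) → Dec (m ≡ m′)
fast ≟M fast = yes _≡_.refl
fast ≟M slow _ = no (λ ())
slow _ ≟M fast = no (λ ())
slow i ≟M slow j with i ℕ.≟ j
... | yes _≡_.refl = yes _≡_.refl
... | no i≢j = no (λ { _≡_.refl → i≢j _≡_.refl })

-- A time interval [a , b) during which a task is processed.
Interval : Set
Interval = ℚ × ℚ

record Assignment : Set where
  constructor assign
  field
    machine : Machine
    pieces  : List Interval
open Assignment public

-- A schedule for a list of tasks assigns the task at position k its
-- Assignment (positions ≥ the length of the list are irrelevant).
Schedule : Set
Schedule = ℕ → Assignment

len : Interval → ℚ
len (a , b) = b - a

totalTime : List Interval → ℚ
totalTime = foldr (λ I acc → len I + acc) 0ℚ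

Disjoint : Interval → Interval → Set
Disjoint (a , b) (c , d) = (b ≤ c) Data.Sum.⊎ (d ≤ a)
  where import Data.Sum

piecesOn : Schedule → ℕ → Machine → List Interval
piecesOn S n m = concatMap (λ k → if does (machine (S k) ≟M m) then pieces (S k) else []) (upTo n)

required : Task → Machine → ℚ
required τ fast     = π τ
required τ (slow _) = σ τ

ValidSchedule : List Task → Schedule → Set
ValidSchedule T S =
    ((k : Fin (length T)) → All (λ I → (proj₁ I < proj₂ I) × (t (lookup T k) ≤ proj₁ I)) (pieces (S (toℕ k))))
  × ((k : Fin (length T)) → totalTime (pieces (S (toℕ k))) ≡ required (lookup T k) (machine (S (toℕ k))))
  × ((m : Machine) → AllPairs Disjoint (piecesOn S (length T) m))

completion : List Task → Schedule → ℚ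
completion T S = foldr (λ k acc → foldr (λ I acc′ → proj₂ I ⊔ acc′) acc (pieces (S k))) 0ℚ (upTo (length T))

fastLoad : List Task → Schedule → ℚ
fastLoad T S = foldr (λ k acc → (if does (machine (S k) ≟M fast) then π (lookupℕ k) else 0ℚ) + acc) 0ℚ (upTo (length T))
  where
    lookupℕ : ℕ → Task
    lookupℕ k = go T k
      where
        go : List Task → ℕ → Task
        go []       _         = task 0ℚ 0ℚ 0ℚ
        go (τ ∷ _)  ℕ.zero    = τ
        go (_ ∷ τs) (ℕ.suc j) = go τs j

IsMinCompletion : List Task → ℚ → Set
IsMinCompletion T c =
    (Σ Schedule λ S → ValidSchedule T S × completion T S ≡ c)
  × ((S : Schedule) → ValidSchedule T S → c ≤ completion T S)

workBefore : Assignment → ℚ → ℚ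
workBefore A s = foldr (λ I acc → (((proj₂ I ⊓ s) - proj₁ I) ⊔ 0ℚ) + acc) 0ℚ (pieces A)

record Scheduler : Set where
  field
    run     : List Task → Schedule
    valid   : (T : List Task) → IsTAP T → ValidSchedule T (run T)
    -- online: what is done before time s ≤ u depends only on 𝒯^u
    online  : (T T′ : List Task) → IsTAP T → IsTAP T′ → (u : ℚ) →
              truncate T u ≡ truncate T′ u →
              (k : ℕ) → k ℕ.< length (truncate T u) → (s : ℚ) → s ≤ u →
              workBefore (run T k) s ≡ workBefore (run T′ k) s
    -- instantly committing: the machine of task k is fixed at its arrival
    -- time, i.e. depends only on 𝒯^{t_k}
    commit  : (T T′ : List Task) → IsTAP T → IsTAP T′ → (k : Fin (length T)) →
              truncate T (t (lookup T k)) ≡ truncate T′ (t (lookup T k)) →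
              machine (run T (toℕ k)) ≡ machine (run T′ (toℕ k))
open Scheduler public

-- Given the values C(s) = C^s, task τ goes to the fast machine iff
-- σ + t > 2 C^{t}; the fast machine processes its tasks in arrival order,
-- each starting as soon as it has arrived and the previous one is done.

insFastCompletion : (ℚ → ℚ) → List Task → ℚ
insFastCompletion C T = foldl step 0ℚ T
  where
    step : ℚ → Task → ℚ
    step F τ = if does ((1ℚ + 1ℚ) * C (t τ) <? σ τ + t τ)
               then (F ⊔ t τ) + π τ
               else F

-- Induction along the arrival order, simultaneously against every valid schedule S (completion
-- time C_S, fast load K_S) of the tasks seen so far; of alg only the validity of its schedule for
-- 𝒯^{t_i} is used. A new task τ raises the fast machine of ins from F to (F ⊔ t) + π if
-- 2 C^{t} < σ + t, and leaves it alone otherwise. If S runs τ on the fast machine, t + π ≤ C_S and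
-- F ≤ C_S + K_S give (F ⊔ t) + π ≤ C_S + (K_S + π). If S runs τ on a slow machine, 2 C^{t} < t + σ ≤ C_S.
-- An optimal schedule O for 𝒯^{t} cannot do the same (that would give 2 C^{t} < C^{t}), so the first
-- case applies to O and yields (F ⊔ t) + π ≤ C^{t} + K_O ≤ 2 C^{t} < C_S, because the fast machine of O
-- is busy for K_O inside [0 , C^{t}].

{-# OPTIONS --safe #-}
module Submission where

open import Defs
open import Algebra.Bundles using (CommutativeMonoid)
open import Data.Bool using (true; false; if_then_else_)
open import Data.Fin using (Fin; toℕ)
import Data.Fin.Properties as Fin
open import Data.List using (List; []; _∷_; _++_; [_]; _∷ʳ_; length; lookup; foldr; filter; upTo; applyUpTo; concatMap)
import Data.List.Properties as List
open import Data.List.Membership.Propositional using (_∈_)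
open import Data.List.Membership.Propositional.Properties using (∈-upTo⁺)
open import Data.List.Relation.Unary.All as All using (All; []; _∷_)
import Data.List.Relation.Unary.All.Properties as All
open import Data.List.Relation.Unary.AllPairs as AllPairs using (AllPairs; []; _∷_)
import Data.List.Relation.Unary.AllPairs.Properties as AllPairs
open import Data.List.Relation.Unary.Any using (here; there)
import Data.List.Relation.Unary.Linked.Properties as Linked
open import Data.List.Reverse using (Reverse; []; _∶_∶ʳ_; reverseView)
open import Data.Nat as ℕ using (ℕ; suc)
import Data.Nat.Properties as ℕ
open import Data.Product using (Σ; ∃; _×_; _,_; proj₁; proj₂)
open import Data.Rational using (ℚ; 0ℚ; 1ℚ; _+_; -_; _-_; _*_; _⊔_; _≤_; _<_)
open import Data.Rational.Properties
open import Data.Sum using (inj₁; inj₂)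
open import Data.Unit using (⊤; tt)
open import Algebra.Properties.AbelianGroup +-0-abelianGroup using (xyx⁻¹≈y)
open import Algebra.Properties.CommutativeSemigroup (CommutativeMonoid.commutativeSemigroup +-0-commutativeMonoid)
  using (x∙yz≈y∙xz)
open import Function using (_∘_; _$_)
open import Relation.Binary.PropositionalEquality using (_≡_; refl; sym; trans; cong; cong₂; subst; module ≡-Reasoning)
open import Relation.Nullary using (Dec; ¬_; does; yes; no; ¬?; contradiction)
open import Relation.Nullary.Decidable using (dec-true; dec-false)
open import Relation.Unary using (Decidable)

p≤p+q : ∀ p {q} → 0ℚ ≤ q → p ≤ p + q
p≤p+q p 0≤q = ≤-trans (≤-reflexive (sym (+-identityʳ p))) (+-monoʳ-≤ p 0≤q)

2*p≡p+p : ∀ p → (1ℚ + 1ℚ) * p ≡ p + p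
2*p≡p+p p = trans (*-distribʳ-+ p 1ℚ 1ℚ) (cong₂ _+_ (*-identityˡ p) (*-identityˡ p))

⊔+-≤ : ∀ {F a p B K} → F ≤ B + K → a + p ≤ B → 0ℚ ≤ p → 0ℚ ≤ K → (F ⊔ a) + p ≤ B + (K + p)
⊔+-≤ {F} {a} {p} {B} {K} F≤B+K a+p≤B 0≤p 0≤K = begin
  (F ⊔ a) + p  ≤⟨ +-monoˡ-≤ p (⊔-lub F≤B+K a≤B+K) ⟩
  (B + K) + p  ≡⟨ +-assoc B K p ⟩
  B + (K + p)  ∎
  where
  open ≤-Reasoning
  a≤B+K : a ≤ B + K
  a≤B+K = ≤-trans (p≤p+q a 0≤p) (≤-trans a+p≤B (p≤p+q B 0≤K))

AllPairs-++⁻ˡ : ∀ {A : Set} {R : A → A → Set} xs {ys} → AllPairs R (xs ++ ys) → AllPairs R xs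
AllPairs-++⁻ˡ []       _          = []
AllPairs-++⁻ˡ (x ∷ xs) (Rx ∷ Rxs) = All.++⁻ˡ xs Rx ∷ AllPairs-++⁻ˡ xs Rxs

AllPairs-++⁻ʳ : ∀ {A : Set} {R : A → A → Set} xs {ys} → AllPairs R (xs ++ ys) → AllPairs R ys
AllPairs-++⁻ʳ []       Rys       = Rys
AllPairs-++⁻ʳ (x ∷ xs) (_ ∷ Rxs) = AllPairs-++⁻ʳ xs Rxs

AllPairs-concatMap⁻ : ∀ {A : Set} {R : A → A → Set} (h : ℕ → List A) {k} ks → k ∈ ks →
                      AllPairs R (concatMap h ks) → AllPairs R (h k)
AllPairs-concatMap⁻ h (k ∷ ks) (here refl)  R* = AllPairs-++⁻ˡ (h k) R*
AllPairs-concatMap⁻ h (j ∷ ks) (there k∈ks) R* = AllPairs-concatMap⁻ h ks k∈ks (AllPairs-++⁻ʳ (h j) R*)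

All-if : ∀ {A : Set} {P : A → Set} b {xs} → All P xs → All P (if b then xs else [])
All-if true  Pxs = Pxs
All-if false _   = []

foldr-applyUpTo-suc : ∀ {A : Set} {f : ℕ → A → A} {e} n →
                      foldr f e (applyUpTo suc n) ≡ foldr (f ∘ suc) e (upTo n)
foldr-applyUpTo-suc {f = f} {e} n = trans (cong (foldr f e) (sym (List.map-upTo suc n))) (List.foldr-map f suc e (upTo n))

-- Disjoint intervals

Inside : ℚ → ℚ → Interval → Set
Inside A B (a , b) = A ≤ a × b ≤ B

totalTime-++ : ∀ xs ys → totalTime (xs ++ ys) ≡ totalTime xs + totalTime ys
totalTime-++ []       ys = sym (+-identityˡ _)
totalTime-++ (I ∷ xs) ys = trans (cong (len I +_) (totalTime-++ xs ys)) (sym (+-assoc (len I) _ _))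

totalTime-filter : ∀ {P : Interval → Set} (P? : Decidable P) L →
                   totalTime L ≡ totalTime (filter P? L) + totalTime (filter (¬? ∘ P?) L)
totalTime-filter P? []      = sym (+-identityʳ 0ℚ)
totalTime-filter P? (I ∷ L) with does (P? I)
... | true  = trans (cong (len I +_) (totalTime-filter P? L)) (sym (+-assoc (len I) _ _))
... | false = trans (cong (len I +_) (totalTime-filter P? L))
                    (x∙yz≈y∙xz (len I) (totalTime (filter P? L)) (totalTime (filter (¬? ∘ P?) L)))

-- Every interval other than the first one, (a , b), lies in [A , a] or in [b , B].
totalTime-disjoint-≤ : ∀ {A B} L → A ≤ B → All (Inside A B) L → AllPairs Disjoint L → A + totalTime L ≤ B
totalTime-disjoint-≤ L = go (length L) L ℕ.≤-refl
  where
  go : ∀ n {A B} L → length L ℕ.≤ n →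
       A ≤ B → All (Inside A B) L → AllPairs Disjoint L → A + totalTime L ≤ B
  go _ [] _ A≤B _ _ = ≤-trans (≤-reflexive (+-identityʳ _)) A≤B
  go _ {A} {B} ((a , b) ∷ L) (ℕ.s≤s |L|≤n) _ ((A≤a , b≤B) ∷ inside) (apart ∷ disjoint) = begin
      A + ((b - a) + totalTime L)  ≡⟨ cong (λ x → A + ((b - a) + x)) (totalTime-filter endsBy? L) ⟩
      A + ((b - a) + (l + r))      ≡⟨ cong (A +_) (x∙yz≈y∙xz (b - a) l r) ⟩
      A + (l + ((b - a) + r))      ≡⟨ sym (+-assoc A l _) ⟩
      (A + l) + ((b - a) + r)      ≤⟨ +-monoˡ-≤ _ left ⟩
      a + ((b - a) + r)            ≡⟨ sym (+-assoc a (b - a) r) ⟩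
      (a + (b - a)) + r            ≡⟨ cong (_+ r) (sym (+-assoc a b (- a))) ⟩
      ((a + b) - a) + r            ≡⟨ cong (_+ r) (xyx⁻¹≈y a b) ⟩
      b + r                        ≤⟨ right ⟩
      B                            ∎
    where
    open ≤-Reasoning
    endsBy? : Decidable (λ I → proj₂ I ≤ a)
    endsBy? I = proj₂ I ≤? a
    l r : ℚ
    l = totalTime (filter endsBy? L)
    r = totalTime (filter (¬? ∘ endsBy?) L)
    after : ∀ {I} → Disjoint (a , b) I → ¬ proj₂ I ≤ a → b ≤ proj₁ I
    after (inj₁ b≤c) _   = b≤c
    after (inj₂ d≤a) d≰a = contradiction d≤a d≰a
    left : A + l ≤ a
    left = go _ (filter endsBy? L) (ℕ.≤-trans (List.length-filter endsBy? L) |L|≤n) A≤a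
              (All.zipWith (λ ((A≤c , _) , d≤a) → A≤c , d≤a)
                 (All.filter⁺ endsBy? inside , All.all-filter endsBy? L))
              (AllPairs.filter⁺ endsBy? disjoint)
    right : b + r ≤ B
    right = go _ (filter (¬? ∘ endsBy?) L) (ℕ.≤-trans (List.length-filter (¬? ∘ endsBy?) L) |L|≤n) b≤B
              (All.zipWith (λ (((_ , d≤B) , ab-I) , d≰a) → after ab-I d≰a , d≤B)
                 (All.zip (All.filter⁺ (¬? ∘ endsBy?) inside , All.filter⁺ (¬? ∘ endsBy?) apart)
                 , All.all-filter (¬? ∘ endsBy?) L))
              (AllPairs.filter⁺ (¬? ∘ endsBy?) disjoint)

WellFormed : Task → Set
WellFormed τ = (0ℚ < σ τ) × (0ℚ < π τ) × (0ℚ ≤ t τ)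

record DoneBy (B : ℚ) (τ : Task) (A : Assignment) : Set where
  field
    nondegenerate : All (λ I → proj₁ I < proj₂ I) (pieces A)
    inside        : All (Inside (t τ) B) (pieces A)
    disjoint      : AllPairs Disjoint (pieces A)
    total         : totalTime (pieces A) ≡ required τ (machine A)

0<required : ∀ {τ} → WellFormed τ → ∀ m → 0ℚ < required τ m
0<required (0<σ , _ , _) (slow _) = 0<σ
0<required (_ , 0<π , _) fast     = 0<π

0<totalTime-inside⇒≤ : ∀ {A B} ps → 0ℚ < totalTime ps → All (λ I → proj₁ I < proj₂ I) ps →
                        All (Inside A B) ps → A ≤ B
0<totalTime-inside⇒≤ []      0<0 _          _                  = contradiction 0<0 (<-irrefl refl)
0<totalTime-inside⇒≤ (_ ∷ _) _   (a<b ∷ _) ((A≤a , b≤B) ∷ _) = ≤-trans A≤a (≤-trans (<⇒≤ a<b) b≤B)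

arrival+required≤ : ∀ {B τ A} → WellFormed τ → DoneBy B τ A → t τ + required τ (machine A) ≤ B
arrival+required≤ {B} {τ} {A} wf done =
  subst (λ r → t τ + r ≤ B) total (totalTime-disjoint-≤ (pieces A) arrival≤B inside disjoint)
  where
  open DoneBy done
  arrival≤B : t τ ≤ B
  arrival≤B = 0<totalTime-inside⇒≤ (pieces A) (subst (0ℚ <_) (sym total) (0<required wf (machine A)))
                nondegenerate inside

onMachine : Machine → Assignment → List Interval
onMachine m A = if does (machine A ≟M m) then pieces A else []

onMachine-own : ∀ A → onMachine (machine A) A ≡ pieces A
onMachine-own A = cong (λ b → if b then pieces A else []) (dec-true (machine A ≟M machine A) refl)

fastCost : Task → Assignment → ℚ
fastCost τ A = if does (machine A ≟M fast) then π τ else 0ℚ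

fastCost-fast : ∀ τ {A} → machine A ≡ fast → fastCost τ A ≡ π τ
fastCost-fast τ eq = cong (λ m → if does (m ≟M fast) then π τ else 0ℚ) eq

0≤fastCost : ∀ {τ} A → WellFormed τ → 0ℚ ≤ fastCost τ A
0≤fastCost (assign fast     _) (_ , 0<π , _) = <⇒≤ 0<π
0≤fastCost (assign (slow _) _) _             = ≤-refl

totalTime-onFast : ∀ {B τ} A → DoneBy B τ A → totalTime (onMachine fast A) ≡ fastCost τ A
totalTime-onFast (assign fast     _) done = DoneBy.total done
totalTime-onFast (assign (slow _) _) _    = refl

shift : ℕ → Schedule → Schedule
shift n S k = S (n ℕ.+ k)

AllDoneBy : ℚ → List Task → Schedule → Set
AllDoneBy B []      S = ⊤
AllDoneBy B (τ ∷ L) S = DoneBy B τ (S 0) × AllDoneBy B L (shift 1 S)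

allDoneBy-++⁻ : ∀ {B R S} P → AllDoneBy B (P ++ R) S → AllDoneBy B P S × AllDoneBy B R (shift (length P) S)
allDoneBy-++⁻ []      done       = tt , done
allDoneBy-++⁻ (τ ∷ P) (d , done) with allDoneBy-++⁻ P done
... | doneP , doneR = (d , doneP) , doneR

allDoneBy-∷ʳ⁻ : ∀ {B τ S} P → AllDoneBy B (P ∷ʳ τ) S → AllDoneBy B P S × DoneBy B τ (S (length P))
allDoneBy-∷ʳ⁻ {B} {τ} {S} P done with allDoneBy-++⁻ P done
... | doneP , (doneτ , _) = doneP , subst (λ k → DoneBy B τ (S k)) (ℕ.+-identityʳ (length P)) doneτ

allDoneBy-tabulate : ∀ {B S} L → ((k : Fin (length L)) → DoneBy B (lookup L k) (S (toℕ k))) → AllDoneBy B L S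
allDoneBy-tabulate []      _    = tt
allDoneBy-tabulate (τ ∷ L) done = done Fin.zero , allDoneBy-tabulate L (done ∘ Fin.suc)

latestEnd : List Interval → ℚ → ℚ
latestEnd ps c = foldr (λ I acc → proj₂ I ⊔ acc) c ps

EndsBy : ℚ → List Interval → Set
EndsBy B = All (λ I → proj₂ I ≤ B)

≤-latestEnd : ∀ ps c → c ≤ latestEnd ps c
≤-latestEnd []       c = ≤-refl
≤-latestEnd (I ∷ ps) c = ≤-trans (≤-latestEnd ps c) (p≤q⊔p (proj₂ I) _)

endsBy-latestEnd : ∀ ps c → EndsBy (latestEnd ps c) ps
endsBy-latestEnd []       c = []
endsBy-latestEnd (I ∷ ps) c =
  p≤p⊔q (proj₂ I) _ ∷ All.map (λ e → ≤-trans e (p≤q⊔p (proj₂ I) _)) (endsBy-latestEnd ps c)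

finishTime : Schedule → List ℕ → ℚ
finishTime S = foldr (λ k → latestEnd (pieces (S k))) 0ℚ

0≤finishTime : ∀ S ks → 0ℚ ≤ finishTime S ks
0≤finishTime S []       = ≤-refl
0≤finishTime S (k ∷ ks) = ≤-trans (0≤finishTime S ks) (≤-latestEnd (pieces (S k)) _)

endsBy-finishTime : ∀ S {k} ks → k ∈ ks → EndsBy (finishTime S ks) (pieces (S k))
endsBy-finishTime S (k ∷ ks) (here refl)  = endsBy-latestEnd (pieces (S k)) _
endsBy-finishTime S (j ∷ ks) (there k∈ks) =
  All.map (λ e → ≤-trans e (≤-latestEnd (pieces (S j)) _)) (endsBy-finishTime S ks k∈ks)

0≤completion : ∀ L S → 0ℚ ≤ completion L S
0≤completion L S = 0≤finishTime S (upTo (length L))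

endsBy-completion : ∀ L S (k : Fin (length L)) → EndsBy (completion L S) (pieces (S (toℕ k)))
endsBy-completion L S k = endsBy-finishTime S (upTo (length L)) (∈-upTo⁺ (Fin.toℕ<n k))

valid⇒allDoneBy : ∀ L S → ValidSchedule L S → AllDoneBy (completion L S) L S
valid⇒allDoneBy L S (arrival , total , exclusive) = allDoneBy-tabulate L done
  where
  done : (k : Fin (length L)) → DoneBy (completion L S) (lookup L k) (S (toℕ k))
  done k = record
    { nondegenerate = All.map proj₁ (arrival k)
    ; inside        = All.zipWith (λ ((_ , t≤a) , b≤C) → t≤a , b≤C) (arrival k , endsBy-completion L S k)
    ; disjoint      = subst (AllPairs Disjoint) (onMachine-own A)
                        (AllPairs-concatMap⁻ (λ j → onMachine (machine A) (S j)) (upTo (length L))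
                          (∈-upTo⁺ (Fin.toℕ<n k)) (exclusive (machine A)))
    ; total         = total k
    }
    where
    A : Assignment
    A = S (toℕ k)

-- Load of the fast machine

fastLoad-∷ : ∀ τ L S → fastLoad (τ ∷ L) S ≡ fastCost τ (S 0) + fastLoad L (shift 1 S)
fastLoad-∷ τ L S = cong (fastCost τ (S 0) +_) (foldr-applyUpTo-suc (length L))

fastLoad-++ : ∀ P R S → fastLoad (P ++ R) S ≡ fastLoad P S + fastLoad R (shift (length P) S)
fastLoad-++ []      R S = sym (+-identityˡ _)
fastLoad-++ (τ ∷ P) R S = begin
  fastLoad (τ ∷ P ++ R) S                                ≡⟨ fastLoad-∷ τ (P ++ R) S ⟩
  c + fastLoad (P ++ R) (shift 1 S)                      ≡⟨ cong (c +_) (fastLoad-++ P R (shift 1 S)) ⟩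
  c + (fastLoad P (shift 1 S) + fastLoad R S′)           ≡⟨ sym (+-assoc c _ _) ⟩
  (c + fastLoad P (shift 1 S)) + fastLoad R S′           ≡⟨ cong (_+ fastLoad R S′) (sym (fastLoad-∷ τ P S)) ⟩
  fastLoad (τ ∷ P) S + fastLoad R S′                     ∎
  where
  open ≡-Reasoning
  c : ℚ
  c = fastCost τ (S 0)
  S′ : Schedule
  S′ = shift (suc (length P)) S

fastLoad-∷ʳ : ∀ P τ S → fastLoad (P ∷ʳ τ) S ≡ fastLoad P S + fastCost τ (S (length P))
fastLoad-∷ʳ P τ S = begin
  fastLoad (P ∷ʳ τ) S
    ≡⟨ fastLoad-++ P [ τ ] S ⟩
  fastLoad P S + (fastCost τ (S (length P ℕ.+ 0)) + 0ℚ)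
    ≡⟨ cong (fastLoad P S +_) (+-identityʳ _) ⟩
  fastLoad P S + fastCost τ (S (length P ℕ.+ 0))
    ≡⟨ cong (λ k → fastLoad P S + fastCost τ (S k)) (ℕ.+-identityʳ (length P)) ⟩
  fastLoad P S + fastCost τ (S (length P)) ∎
  where open ≡-Reasoning

0≤fastLoad : ∀ L S → All WellFormed L → 0ℚ ≤ fastLoad L S
0≤fastLoad []      S []          = ≤-refl
0≤fastLoad (τ ∷ L) S (wf ∷ wfs) = subst (0ℚ ≤_) (sym (fastLoad-∷ τ L S))
  (≤-trans (0≤fastCost (S 0) wf) (p≤p+q _ (0≤fastLoad L (shift 1 S) wfs)))

fastLoad-≤-++ : ∀ P R S → All WellFormed R → fastLoad P S ≤ fastLoad (P ++ R) S
fastLoad-≤-++ P R S wf =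
  ≤-trans (p≤p+q _ (0≤fastLoad R (shift (length P) S) wf)) (≤-reflexive (sym (fastLoad-++ P R S)))

piecesOn-suc : ∀ S n m → piecesOn S (suc n) m ≡ onMachine m (S 0) ++ piecesOn (shift 1 S) n m
piecesOn-suc S n m = cong (onMachine m (S 0) ++_)
  (trans (cong (concatMap h) (sym (List.map-upTo suc n))) (List.concatMap-map h suc (upTo n)))
  where
  h : ℕ → List Interval
  h k = onMachine m (S k)

totalTime-piecesOn-fast : ∀ {B} L S → AllDoneBy B L S → totalTime (piecesOn S (length L) fast) ≡ fastLoad L S
totalTime-piecesOn-fast []      S _          = refl
totalTime-piecesOn-fast (τ ∷ L) S (d , done) = begin
  totalTime (piecesOn S (suc (length L)) fast)
    ≡⟨ cong totalTime (piecesOn-suc S (length L) fast) ⟩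
  totalTime (onMachine fast (S 0) ++ piecesOn (shift 1 S) (length L) fast)
    ≡⟨ totalTime-++ (onMachine fast (S 0)) _ ⟩
  totalTime (onMachine fast (S 0)) + totalTime (piecesOn (shift 1 S) (length L) fast)
    ≡⟨ cong₂ _+_ (totalTime-onFast (S 0) d) (totalTime-piecesOn-fast L (shift 1 S) done) ⟩
  fastCost τ (S 0) + fastLoad L (shift 1 S)
    ≡⟨ sym (fastLoad-∷ τ L S) ⟩
  fastLoad (τ ∷ L) S ∎
  where open ≡-Reasoning

inside-piecesOn : ∀ {A B} L S m → All (λ τ → A ≤ t τ) L → AllDoneBy B L S →
                  All (Inside A B) (piecesOn S (length L) m)
inside-piecesOn []      S m []           _          = []
inside-piecesOn {A} {B} (τ ∷ L) S m (A≤t ∷ A≤ts) (d , done) =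
  subst (All (Inside A B)) (sym (piecesOn-suc S (length L) m))
    (All.++⁺ (All-if _ (All.map (λ (t≤a , b≤B) → ≤-trans A≤t t≤a , b≤B) (DoneBy.inside d)))
             (inside-piecesOn L (shift 1 S) m A≤ts done))

fastLoad-≤ : ∀ {A B} L S → A ≤ B → All (λ τ → A ≤ t τ) L → AllDoneBy B L S →
             AllPairs Disjoint (piecesOn S (length L) fast) → A + fastLoad L S ≤ B
fastLoad-≤ {A} {B} L S A≤B A≤ts done disjoint =
  subst (λ x → A + x ≤ B) (totalTime-piecesOn-fast L S done)
    (totalTime-disjoint-≤ _ A≤B (inside-piecesOn L S fast A≤ts done) disjoint)

fastLoad≤completion : ∀ L S → All WellFormed L → ValidSchedule L S → fastLoad L S ≤ completion L S
fastLoad≤completion L S wf valid@(_ , _ , exclusive) =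
  subst (_≤ completion L S) (+-identityˡ _)
    (fastLoad-≤ L S (0≤completion L S) (All.map (proj₂ ∘ proj₂) wf) (valid⇒allDoneBy L S valid) (exclusive fast))

-- Truncations of a sorted arrival process

_≤ₜ_ : Task → Task → Set
τ ≤ₜ τ′ = t τ ≤ t τ′

arrivedBy? : (s : ℚ) → Decidable (λ τ → t τ ≤ s)
arrivedBy? s τ = t τ ≤? s

truncate-++ : ∀ s X R → All (λ τ → t τ ≤ s) X → truncate (X ++ R) s ≡ X ++ truncate R s
truncate-++ s X R X≤s =
  trans (List.filter-++ (arrivedBy? s) X R) (cong (_++ truncate R s) (List.filter-all (arrivedBy? s) X≤s))

truncate-prefix : ∀ s {T} → AllPairs _≤ₜ_ T → ∃ λ R → T ≡ truncate T s ++ R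
truncate-prefix s {[]}    []             = [] , refl
truncate-prefix s {τ ∷ T} (τ≤T ∷ sorted) with t τ ≤? s
... | yes τ≤s = let R , T≡ = truncate-prefix s sorted in
                R , trans (cong (τ ∷_) T≡) (cong (_++ R) (sym (List.filter-accept (arrivedBy? s) τ≤s)))
... | no  τ≰s = τ ∷ T , cong (_++ τ ∷ T) (sym (trans (List.filter-reject (arrivedBy? s) τ≰s)
                  (List.filter-none (arrivedBy? s) (All.map (λ τ≤τ′ → τ≰s ∘ ≤-trans τ≤τ′) τ≤T))))

≤ₜ-earlier : ∀ P {τ R} → AllPairs _≤ₜ_ (P ++ τ ∷ R) → All (_≤ₜ τ) P
≤ₜ-earlier []      _               = []
≤ₜ-earlier (x ∷ P) (x≤later ∷ sorted) = All.head (All.++⁻ʳ P x≤later) ∷ ≤ₜ-earlier P sorted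

-- The fast machine of ins

SentToFast : (ℚ → ℚ) → Task → Set
SentToFast C τ = (1ℚ + 1ℚ) * C (t τ) < σ τ + t τ

sentToFast? : ∀ C τ → Dec (SentToFast C τ)
sentToFast? C τ = (1ℚ + 1ℚ) * C (t τ) <? σ τ + t τ

insStep : (ℚ → ℚ) → ℚ → Task → ℚ
insStep C F τ = if does (sentToFast? C τ) then (F ⊔ t τ) + π τ else F

insFastCompletion-∷ʳ : ∀ C P τ → insFastCompletion C (P ∷ʳ τ) ≡ insStep C (insFastCompletion C P) τ
insFastCompletion-∷ʳ C P τ = List.foldl-∷ʳ (insStep C) 0ℚ τ P

insStep-fast : ∀ C τ F → SentToFast C τ → insStep C F τ ≡ (F ⊔ t τ) + π τ
insStep-fast C τ F fast′ = cong (λ b → if b then (F ⊔ t τ) + π τ else F) (dec-true (sentToFast? C τ) fast′)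

insStep-slow : ∀ C τ F → ¬ SentToFast C τ → insStep C F τ ≡ F
insStep-slow C τ F slow′ = cong (λ b → if b then (F ⊔ t τ) + π τ else F) (dec-false (sentToFast? C τ) slow′)

slow⇒2C<B : ∀ C {B τ A j} → WellFormed τ → SentToFast C τ → machine A ≡ slow j → DoneBy B τ A →
            (1ℚ + 1ℚ) * C (t τ) < B
slow⇒2C<B C {B} {τ} {A} wf toFast onSlow done = begin-strict
  (1ℚ + 1ℚ) * C (t τ)          <⟨ toFast ⟩
  σ τ + t τ                    ≡⟨ +-comm (σ τ) (t τ) ⟩
  t τ + σ τ                    ≡⟨ cong (λ m → t τ + required τ m) (sym onSlow) ⟩
  t τ + required τ (machine A) ≤⟨ arrival+required≤ wf done ⟩
  B                            ∎
  where open ≤-Reasoning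

module _ (T : List Task) (wf : All WellFormed T) (sorted : AllPairs _≤ₜ_ T)
         (C : ℚ → ℚ) (optimal : (s : ℚ) → IsMinCompletion (truncate T s) (C s)) where

  optimal-prefix : ∀ s X {R} → T ≡ X ++ R → All (λ τ → t τ ≤ s) X →
                   Σ Schedule λ O → AllDoneBy (C s) X O × fastLoad X O ≤ C s
  optimal-prefix s X {R} T≡X++R X≤s with proj₁ (optimal s)
  ... | O , validO , completionO =
    O , proj₁ (allDoneBy-++⁻ X (subst (λ L → AllDoneBy (C s) L O) Q≡ doneQ)) , load≤
    where
    Q : List Task
    Q = truncate T s
    Q≡ : Q ≡ X ++ truncate R s
    Q≡ = trans (cong (λ L → truncate L s) T≡X++R) (truncate-++ s X R X≤s)
    doneQ : AllDoneBy (C s) Q O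
    doneQ = subst (λ c → AllDoneBy c Q O) completionO (valid⇒allDoneBy Q O validO)
    wfR : All WellFormed (truncate R s)
    wfR = All.filter⁺ (arrivedBy? s) (All.++⁻ʳ X (subst (All WellFormed) T≡X++R wf))
    load≤ : fastLoad X O ≤ C s
    load≤ = begin
      fastLoad X O                    ≤⟨ fastLoad-≤-++ X (truncate R s) O wfR ⟩
      fastLoad (X ++ truncate R s) O  ≡⟨ cong (λ L → fastLoad L O) (sym Q≡) ⟩
      fastLoad Q O                    ≤⟨ fastLoad≤completion Q O (All.filter⁺ (arrivedBy? s) wf) validO ⟩
      completion Q O                  ≡⟨ completionO ⟩
      C s                             ∎
      where open ≤-Reasoning

  module _ (P : List Task) (τ : Task) {R : List Task} (T≡ : T ≡ (P ∷ʳ τ) ++ R) (F : ℚ)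
           (ih : ∀ B S → 0ℚ ≤ B → AllDoneBy B (P ∷ʳ τ) S → F ≤ B + fastLoad P S) where

    private
      wfPτ : All WellFormed (P ∷ʳ τ)
      wfPτ = All.++⁻ˡ (P ∷ʳ τ) (subst (All WellFormed) T≡ wf)
      wfP : All WellFormed P
      wfP = proj₁ (All.∷ʳ⁻ wfPτ)
      wfτ : WellFormed τ
      wfτ = proj₂ (All.∷ʳ⁻ wfPτ)
      arrived : All (λ x → t x ≤ t τ) (P ∷ʳ τ)
      arrived = All.∷ʳ⁺ (≤ₜ-earlier P (subst (AllPairs _≤ₜ_) (trans T≡ (List.++-assoc P [ τ ] R)) sorted))
                        ≤-refl

    fastStep-≤ : ∀ {B S} → 0ℚ ≤ B → AllDoneBy B (P ∷ʳ τ) S → machine (S (length P)) ≡ fast →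
                 (F ⊔ t τ) + π τ ≤ B + fastLoad (P ∷ʳ τ) S
    fastStep-≤ {B} {S} 0≤B done onFast = begin
      (F ⊔ t τ) + π τ
        ≤⟨ ⊔+-≤ (ih B S 0≤B done) t+π≤B (<⇒≤ (proj₁ (proj₂ wfτ))) (0≤fastLoad P S wfP) ⟩
      B + (fastLoad P S + π τ)
        ≡⟨ cong (λ c → B + (fastLoad P S + c)) (sym (fastCost-fast τ {S (length P)} onFast)) ⟩
      B + (fastLoad P S + fastCost τ (S (length P)))
        ≡⟨ cong (B +_) (sym (fastLoad-∷ʳ P τ S)) ⟩
      B + fastLoad (P ∷ʳ τ) S ∎
      where
      open ≤-Reasoning
      t+π≤B : t τ + π τ ≤ B
      t+π≤B = subst (λ m → t τ + required τ m ≤ B) onFast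
                (arrival+required≤ wfτ (proj₂ (allDoneBy-∷ʳ⁻ P done)))

    fastStep-≤2C : SentToFast C τ → (F ⊔ t τ) + π τ ≤ (1ℚ + 1ℚ) * C (t τ)
    fastStep-≤2C toFast with optimal-prefix (t τ) (P ∷ʳ τ) T≡ arrived
    ... | O , doneO , loadO = onOptimal (machine (O (length P))) refl
      where
      0≤C : 0ℚ ≤ C (t τ)
      0≤C = ≤-trans (0≤fastLoad (P ∷ʳ τ) O wfPτ) loadO
      C≤2C : C (t τ) ≤ (1ℚ + 1ℚ) * C (t τ)
      C≤2C = ≤-trans (p≤p+q _ 0≤C) (≤-reflexive (sym (2*p≡p+p (C (t τ)))))
      onOptimal : ∀ m → machine (O (length P)) ≡ m → (F ⊔ t τ) + π τ ≤ (1ℚ + 1ℚ) * C (t τ)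
      onOptimal fast onO = begin
        (F ⊔ t τ) + π τ                ≤⟨ fastStep-≤ 0≤C doneO onO ⟩
        C (t τ) + fastLoad (P ∷ʳ τ) O  ≤⟨ +-monoʳ-≤ (C (t τ)) loadO ⟩
        C (t τ) + C (t τ)              ≡⟨ sym (2*p≡p+p (C (t τ))) ⟩
        (1ℚ + 1ℚ) * C (t τ)            ∎
        where open ≤-Reasoning
      onOptimal (slow _) onO =
        contradiction (<-≤-trans (slow⇒2C<B C wfτ toFast onO (proj₂ (allDoneBy-∷ʳ⁻ P doneO))) C≤2C)
                      (<-irrefl refl)

    insStep-≤ : ∀ B S → 0ℚ ≤ B → AllDoneBy B (P ∷ʳ τ) S → insStep C F τ ≤ B + fastLoad (P ∷ʳ τ) S
    insStep-≤ B S 0≤B done = bound (sentToFast? C τ) (machine (S (length P))) refl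
      where
      open ≤-Reasoning
      bound : Dec (SentToFast C τ) → ∀ m → machine (S (length P)) ≡ m →
              insStep C F τ ≤ B + fastLoad (P ∷ʳ τ) S
      bound (no ¬toFast) _ _ = begin
        insStep C F τ
          ≡⟨ insStep-slow C τ F ¬toFast ⟩
        F
          ≤⟨ ih B S 0≤B done ⟩
        B + fastLoad P S
          ≤⟨ +-monoʳ-≤ B (p≤p+q _ (0≤fastCost (S (length P)) wfτ)) ⟩
        B + (fastLoad P S + fastCost τ (S (length P)))
          ≡⟨ cong (B +_) (sym (fastLoad-∷ʳ P τ S)) ⟩
        B + fastLoad (P ∷ʳ τ) S ∎
      bound (yes toFast) fast onS = begin
        insStep C F τ            ≡⟨ insStep-fast C τ F toFast ⟩
        (F ⊔ t τ) + π τ          ≤⟨ fastStep-≤ 0≤B done onS ⟩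
        B + fastLoad (P ∷ʳ τ) S  ∎
      bound (yes toFast) (slow _) onS = <⇒≤ $ begin-strict
        insStep C F τ            ≡⟨ insStep-fast C τ F toFast ⟩
        (F ⊔ t τ) + π τ          ≤⟨ fastStep-≤2C toFast ⟩
        (1ℚ + 1ℚ) * C (t τ)      <⟨ slow⇒2C<B C wfτ toFast onS (proj₂ (allDoneBy-∷ʳ⁻ P done)) ⟩
        B                        ≤⟨ p≤p+q B (0≤fastLoad (P ∷ʳ τ) S wfPτ) ⟩
        B + fastLoad (P ∷ʳ τ) S  ∎

  insFastCompletion-≤ : ∀ {P} → Reverse P → ∀ {R} → T ≡ P ++ R →
                        ∀ B S → 0ℚ ≤ B → AllDoneBy B P S → insFastCompletion C P ≤ B + fastLoad P S
  insFastCompletion-≤ [] _ B S 0≤B _ = ≤-trans 0≤B (≤-reflexive (sym (+-identityʳ B)))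
  insFastCompletion-≤ (P ∶ rP ∶ʳ τ) {R} T≡ B S 0≤B done =
    subst (_≤ B + fastLoad (P ∷ʳ τ) S) (sym (insFastCompletion-∷ʳ C P τ))
      (insStep-≤ P τ T≡ (insFastCompletion C P) ih B S 0≤B done)
    where
    ih : ∀ B S → 0ℚ ≤ B → AllDoneBy B (P ∷ʳ τ) S → insFastCompletion C P ≤ B + fastLoad P S
    ih B S 0≤B done =
      insFastCompletion-≤ rP (trans T≡ (List.++-assoc P [ τ ] R)) B S 0≤B (proj₁ (allDoneBy-∷ʳ⁻ P done))

lemma3p1 : (T : List Task) → IsTAP T →
    (C : ℚ → ℚ) → ((s : ℚ) → IsMinCompletion (truncate T s) (C s)) →
    (i : Fin (length T)) → (alg : Scheduler) →
    insFastCompletion C (truncate T (t (lookup T i)))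
    ≤ completion (truncate T (t (lookup T i))) (run alg (truncate T (t (lookup T i))))
    + fastLoad (truncate T (t (lookup T i))) (run alg (truncate T (t (lookup T i))))
lemma3p1 T (wf , linked) C optimal i alg =
  insFastCompletion-≤ T wf sorted C optimal (reverseView L) (proj₂ (truncate-prefix s sorted))
    (completion L S) S (0≤completion L S) (valid⇒allDoneBy L S (valid alg L tapL))
  where
  sorted : AllPairs _≤ₜ_ T
  sorted = Linked.Linked⇒AllPairs ≤-trans linked
  s : ℚ
  s = t (lookup T i)
  L : List Task
  L = truncate T s
  S : Schedule
  S = run alg L
  tapL : IsTAP L
  tapL = All.filter⁺ (arrivedBy? s) wf , Linked.filter⁺ (arrivedBy? s) ≤-trans linked
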